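{- Let $d\ge 8$. Let $P^5_d$ be the graph obtained from $K_{d+1}$ by deleting the edges of two paths of length 2 and of a 3-cycle, these three subgraphs being pairwise vertex-disjoint, and then deleting the edges of a maximum matching on the $d-8$ vertices not involved in these paths or this 3-cycle. Then $P^5_d$ is a $d$-pod.
   Context: A graph $H$ is immersed in a multigraph $G$ if there is an injection $\phi:V(H)\to V(G)$ and an assignment to each edge $uv\in E(H)$ of a path in $G$ between $\phi(u)$ and $\phi(v)$ with paths of distinct edges pairwise edge-disjoint. For a positive integer $d$, a $d$-pod is a simple graph in which every vertex has degree at least $d-2$ and at most $d-2$ vertices have degree exactly $d-2$, and such that, letting $A$ be its set of vertices of degree exactly $d-2$, for every maximum matching on $A$ (i.e. $\lfloor |A|/2\rfloor$ pairwise disjoint pairs of vertices of $A$), the multigraph obtained by adding one new edge joining each chosen pair (parallel edges allowed) has no immersion of $K_d$. -}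

module Defs where

open import Data.Nat using (ℕ; zero; suc; _≤_; _<_; _≡ᵇ_; _≤ᵇ_; _<ᵇ_; ⌊_/2⌋; _∸_)
open import Data.Bool using (Bool; true; false; not; _∧_; _∨_; T)
open import Data.Fin using (Fin; toℕ)
open import Data.List using (List; []; _∷_; _++_; length; map; concatMap; filterᵇ; allFin; lookup)
open import Data.List.Membership.Propositional using (_∈_)
open import Data.List.Relation.Unary.All using (All)
open import Data.List.Relation.Unary.Unique.Propositional using (Unique)
open import Data.Product using (Σ; _×_; _,_; proj₁; proj₂; ∃)
open import Data.Sum using (_⊎_)
open import Data.Empty using (⊥)
open import Relation.Binary.PropositionalEquality using (_≡_; _≢_)
open import Relation.Nullary using (¬_)

Adjacency : ℕ → Set
Adjacency n = Fin n → Fin n → Bool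

IsSimple : ∀ {n} → Adjacency n → Set
IsSimple {n} adj = (∀ (i j : Fin n) → adj i j ≡ adj j i) × (∀ (i : Fin n) → adj i i ≡ false)

deg : ∀ {n} → Adjacency n → Fin n → ℕ
deg {n} adj i = length (filterᵇ (adj i) (allFin n))

degEq : ∀ {n} → Adjacency n → ℕ → List (Fin n)
degEq {n} adj k = filterᵇ (λ i → deg adj i ≡ᵇ k) (allFin n)

edgeList : ∀ {n} → Adjacency n → List (Fin n × Fin n)
edgeList {n} adj =
  concatMap (λ i → map (λ j → (i , j))
                       (filterᵇ (λ j → (toℕ i <ᵇ toℕ j) ∧ adj i j) (allFin n)))
            (allFin n)

-- Multigraphs on Fin n: a list of edges (parallel edges allowed);
-- edges are identified by their position in the list.

Multigraph : ℕ → Set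
Multigraph n = List (Fin n × Fin n)

EdgeOf : ∀ {n} → Multigraph n → Set
EdgeOf M = Fin (length M)

Joins : ∀ {n} (M : Multigraph n) → EdgeOf M → Fin n → Fin n → Set
Joins M e u w =
  (proj₁ (lookup M e) ≡ u × proj₂ (lookup M e) ≡ w) ⊎
  (proj₁ (lookup M e) ≡ w × proj₂ (lookup M e) ≡ u)

data Walk {n} (M : Multigraph n) : Fin n → Fin n → Set where
  nil  : ∀ {u} → Walk M u u
  cons : ∀ {u w v} (e : EdgeOf M) → Joins M e u w → Walk M w v → Walk M u v

walkVerts : ∀ {n} {M : Multigraph n} {u v} → Walk M u v → List (Fin n)
walkVerts {u = u} nil = u ∷ []
walkVerts {u = u} (cons e _ w) = u ∷ walkVerts w

walkEdges : ∀ {n} {M : Multigraph n} {u v} → Walk M u v → List (EdgeOf M)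
walkEdges nil = []
walkEdges (cons e _ w) = e ∷ walkEdges w

record Path {n} (M : Multigraph n) (u v : Fin n) : Set where
  field
    walk   : Walk M u v
    simple : Unique (walkVerts walk)
open Path public

ImmersesK : ∀ {n} (d : ℕ) → Multigraph n → Set
ImmersesK {n} d M =
  Σ (Fin d → Fin n) λ φ →
    (∀ i j → φ i ≡ φ j → i ≡ j) ×
    Σ (∀ (i j : Fin d) → toℕ i < toℕ j → Path M (φ i) (φ j)) λ P →
      ∀ i j i' j' (p : toℕ i < toℕ j) (p' : toℕ i' < toℕ j') →
        ¬ (i ≡ i' × j ≡ j') →
        ∀ e → e ∈ walkEdges (walk (P i j p)) → e ∈ walkEdges (walk (P i' j' p')) → ⊥

endpoints : ∀ {n} → List (Fin n × Fin n) → List (Fin n)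
endpoints [] = []
endpoints ((a , b) ∷ ps) = a ∷ b ∷ endpoints ps

IsMatchingOn : ∀ {n} → List (Fin n) → List (Fin n × Fin n) → Set
IsMatchingOn A ps = All (λ x → x ∈ A) (endpoints ps) × Unique (endpoints ps)

IsMaxMatchingOn : ∀ {n} → List (Fin n) → List (Fin n × Fin n) → Set
IsMaxMatchingOn A ps = IsMatchingOn A ps × length ps ≡ ⌊ length A /2⌋

IsPod : ∀ {n} (d : ℕ) → Adjacency n → Set
IsPod {n} d adj =
  IsSimple adj ×
  (∀ (i : Fin n) → d ∸ 2 ≤ deg adj i) ×
  length (degEq adj (d ∸ 2)) ≤ d ∸ 2 ×
  (∀ (ps : List (Fin n × Fin n)) → IsMaxMatchingOn (degEq adj (d ∸ 2)) ps →
     ¬ ImmersesK d (edgeList adj ++ ps))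

-- The graph P^5_d on vertex set {0,...,d}:
-- deleted paths 0-1-2 and 3-4-5, deleted triangle 6-7-8, and the deleted
-- maximum matching {9,10},{11,12},... on the d-8 vertices 9..d.

delPair : ℕ → ℕ → Bool
delPair 0 1 = true
delPair 1 2 = true
delPair 3 4 = true
delPair 4 5 = true
delPair 6 7 = true
delPair 7 8 = true
delPair 6 8 = true
delPair a b = (9 ≤ᵇ a) ∧ (9 ≤ᵇ b) ∧ not (a ≡ᵇ b) ∧ (⌊ a ∸ 9 /2⌋ ≡ᵇ ⌊ b ∸ 9 /2⌋)

P5 : (d : ℕ) → Adjacency (suc d)
P5 d i j = not (toℕ i ≡ᵇ toℕ j) ∧ not (delPair (toℕ i) (toℕ j) ∨ delPair (toℕ j) (toℕ i))

module Submission where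

-- Write d = 8 + m.  The vertices 0..8 of P^5_d are "low", 9..d "high".  Every low vertex is
-- adjacent to every high one, so a low vertex has degree (its degree in P^5_8) + m: d - 2 for
-- the five "tight" vertices 1,4,6,7,8 and d - 1 for the others; a high vertex misses at most
-- itself and its mate, so its degree is at least d - 1.  This gives the degree conditions, and
-- the set A of vertices of degree d - 2 consists of tight vertices.
--
-- For the immersion condition we first prove two general facts.  (1) `WithMatching`: adding a
-- matching on the vertices of degree d - 2 to a simple graph on d + 1 vertices gives a
-- multigraph M in which every vertex lies on at most d edges, and an unmatched vertex on at most
-- its degree.  (2) `KImmersion`: if K_d is immersed in such an M and a vertex u lies on k < d - 1
-- edges, then u is no branch vertex, no route passes through a branch vertex, so the route between
-- two non-adjacent vertices other than u passes through u; hence j distinct such pairs give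
-- 2 j ≤ k (`detours-≤`).  For P^5_d some tight vertex u is unmatched (a maximum matching on at most
-- five vertices covers at most four), and we exhibit 4 + ⌊m/2⌋ such pairs: four among the low
-- vertices (sides of the deleted paths and triangle) and the deleted matching on the high ones.
-- As 2 (4 + ⌊m/2⌋) > d - 2, there is no immersion.

open import Defs
open import Data.Nat using (ℕ; zero; suc; _+_; _*_; _∸_; _≤_; _<_; z≤n; s≤s; _≡ᵇ_; _<ᵇ_; ⌊_/2⌋; _<?_; _≤?_)
import Data.Nat.Properties as ℕₚ
open ℕₚ
open import Data.Bool using (Bool; true; false; not; _∧_; _∨_; T; T?)
import Data.Bool.Properties as Boolₚ
open Boolₚ using (T-∧; T-≡; ¬-not; ∨-comm)
open import Function using (_∘_; Equivalence; case_of_)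
open import Data.Fin using (Fin; zero; suc; toℕ; punchIn; _↑ˡ_; _↑ʳ_; splitAt; #_)
import Data.Fin.Properties as Finₚ
open import Data.List using (List; []; _∷_; _++_; length; map; filterᵇ; allFin; lookup; tabulate)
open import Data.List.Properties using (length-tabulate; length-map; length-++; length-++-sucʳ; filter-all)
open import Data.List.Membership.Propositional using (_∈_; _∉_; find; lose)
open import Data.List.Membership.Propositional.Properties
  using ( ∈-allFin; ∈-++⁻; ∈-++⁺ˡ; ∈-++⁺ʳ; ∈-lookup; ∈-map⁻; ∈-map⁺; ∈-filter⁺; ∈-filter⁻; ∈-∃++
        ; ∈-concatMap⁻; ∈-tabulate⁻)
open import Data.List.Relation.Binary.Subset.Propositional using (_⊆_)
open import Data.List.Relation.Unary.Any as Any using (here; there; satisfied)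
open import Data.List.Relation.Unary.All as All using (All; []; _∷_)
open import Data.List.Relation.Unary.AllPairs as AllPairs using (AllPairs; []; _∷_)
import Data.List.Relation.Unary.AllPairs.Properties as AllPairsP
import Data.List.Relation.Unary.All.Properties as AllP
open import Data.List.Relation.Binary.Disjoint.Propositional using (Disjoint)
open import Data.List.Relation.Unary.Unique.Propositional using (Unique)
open import Data.List.Relation.Unary.Unique.Propositional.Properties
  using (allFin⁺; filter⁺; map⁺; ++⁺; concat⁺; tabulate⁺)
open import Data.Product as Product using (Σ; _×_; _,_; proj₁; proj₂)
open import Data.Sum as Sum using (_⊎_; inj₁; inj₂)
open import Data.Empty using (⊥; ⊥-elim)
open import Data.Unit using (tt)
open import Relation.Nullary using (¬_; Dec; yes; no)
open import Relation.Nullary.Decidable using (from-yes; decidable-stable; ¬?; True; toWitness; _×-dec_; _⊎-dec_)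
open import Data.Product.Properties using (≡-dec)
open import Relation.Binary.PropositionalEquality

unique-⊆-length : ∀ {A : Set} {xs ys : List A} → Unique xs → xs ⊆ ys → length xs ≤ length ys
unique-⊆-length {xs = []} _ _ = z≤n
unique-⊆-length {xs = x ∷ xs} (x∉xs ∷ unique) xs⊆ys
  with ys₁ , ys₂ , refl ← ∈-∃++ (xs⊆ys (here refl)) =
  subst (suc (length xs) ≤_) (sym (length-++-sucʳ ys₁ x ys₂)) (s≤s (unique-⊆-length unique shrink))
  where
  shrink : xs ⊆ ys₁ ++ ys₂
  shrink {z} z∈xs with ∈-++⁻ ys₁ (xs⊆ys (there z∈xs))
  ... | inj₁ z∈ys₁ = ∈-++⁺ˡ z∈ys₁
  ... | inj₂ (here refl) = ⊥-elim (All.lookup x∉xs z∈xs refl)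
  ... | inj₂ (there z∈ys₂) = ∈-++⁺ʳ ys₁ z∈ys₂

unique-Fin-length : ∀ {n} {xs : List (Fin n)} → Unique xs → length xs ≤ n
unique-Fin-length {n} {xs} unique =
  subst (length xs ≤_) (length-tabulate {n = n} (λ i → i)) (unique-⊆-length unique (λ {z} _ → ∈-allFin z))

length-filter-complement : ∀ {A : Set} (p : A → Bool) xs →
  length (filterᵇ p xs) + length (filterᵇ (λ x → not (p x)) xs) ≡ length xs
length-filter-complement p [] = refl
length-filter-complement p (x ∷ xs) with p x
... | true = cong suc (length-filter-complement p xs)
... | false = trans (+-suc _ _) (cong suc (length-filter-complement p xs))

∈-filterᵇ⁻ : ∀ {A : Set} (p : A → Bool) {xs x} → x ∈ filterᵇ p xs → T (p x)
∈-filterᵇ⁻ p {xs} x∈ = proj₂ (∈-filter⁻ (T? ∘ p) {xs = xs} x∈)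

∈-filterᵇ⁺ : ∀ {A : Set} (p : A → Bool) {xs x} → x ∈ xs → T (p x) → x ∈ filterᵇ p xs
∈-filterᵇ⁺ p x∈ px = ∈-filter⁺ (T? ∘ p) x∈ px

Increasing : ∀ {n} → Adjacency n → Fin n × Fin n → Set
Increasing adj (p , q) = toℕ p < toℕ q × T (adj p q)

module _ {n} (adj : Adjacency n) where
  private
    later : Fin n → Fin n → Bool
    later i j = (toℕ i <ᵇ toℕ j) ∧ adj i j
    row : Fin n → List (Fin n × Fin n)
    row i = map (i ,_) (filterᵇ (later i) (allFin n))

  edgeList-increasing : All (Increasing adj) (edgeList adj)
  edgeList-increasing = All.tabulate increasing
    where
    increasing : ∀ {pq} → pq ∈ edgeList adj → Increasing adj pq
    increasing pq∈ with i , pq∈row ← satisfied (∈-concatMap⁻ row {xs = allFin n} pq∈)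
                  with j , j∈ , refl ← ∈-map⁻ (i ,_) pq∈row
                  with i<j , adj-ij ← Equivalence.to T-∧ (∈-filterᵇ⁻ (later i) {xs = allFin n} j∈) =
      <ᵇ⇒< (toℕ i) (toℕ j) i<j , adj-ij

  edgeList-unique : Unique (edgeList adj)
  edgeList-unique = concat⁺ (AllP.map⁺ (All.universal row-unique (allFin n)))
                            (AllPairsP.map⁺ (AllPairs.map rows-disjoint (allFin⁺ n)))
    where
    row-unique : ∀ i → Unique (row i)
    row-unique i = map⁺ (cong proj₂) (filter⁺ _ (allFin⁺ n))
    rows-disjoint : ∀ {i j} → i ≢ j → Disjoint (row i) (row j)
    rows-disjoint i≢j (v∈i , v∈j) with _ , _ , refl ← ∈-map⁻ _ v∈i | _ , _ , eq ← ∈-map⁻ _ v∈j =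
      i≢j (cong proj₁ eq)

deg-< : ∀ {n} (adj : Adjacency n) → IsSimple adj → ∀ x → deg adj x < n
deg-< {n} adj (_ , loopless) x =
  unique-Fin-length (All.tabulate x-not-neighbour ∷ filter⁺ _ (allFin⁺ n))
  where
  x-not-neighbour : ∀ {y} → y ∈ filterᵇ (adj x) (allFin n) → x ≢ y
  x-not-neighbour y∈ refl = subst T (loopless x) (∈-filterᵇ⁻ (adj x) {xs = allFin n} y∈)

Incident : ∀ {n} (L : Multigraph n) → EdgeOf L → Fin n → Set
Incident L e x = proj₁ (lookup L e) ≡ x ⊎ proj₂ (lookup L e) ≡ x

AtMostIncident : ∀ {n} → Multigraph n → Fin n → ℕ → Set
AtMostIncident L x k =
  ∀ (es : List (EdgeOf L)) → Unique es → All (λ e → Incident L e x) es → length es ≤ k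

neighbours : ∀ {n} → Fin n → List (Fin n × Fin n) → List (Fin n)
neighbours x [] = []
neighbours x ((p , q) ∷ L) with x Finₚ.≟ p | x Finₚ.≟ q
... | yes _ | _     = q ∷ neighbours x L
... | no _  | yes _ = p ∷ neighbours x L
... | no _  | no _  = neighbours x L

-- The edges of `pq ∷ L` other than the first one, renamed as edges of L.
laterEdges : ∀ {k} → List (Fin (suc k)) → List (Fin k)
laterEdges [] = []
laterEdges (zero ∷ es) = laterEdges es
laterEdges (suc e ∷ es) = e ∷ laterEdges es

module _ {k : ℕ} where
  laterEdges-length : {es : List (Fin (suc k))} → All (_≢ zero) es → length es ≤ length (laterEdges es)
  laterEdges-length {[]} _ = z≤n
  laterEdges-length {zero ∷ es} (nonzero ∷ _) = ⊥-elim (nonzero refl)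
  laterEdges-length {suc e ∷ es} (_ ∷ nonzero) = s≤s (laterEdges-length nonzero)

  laterEdges-length-unique : {es : List (Fin (suc k))} → Unique es → length es ≤ suc (length (laterEdges es))
  laterEdges-length-unique {[]} _ = z≤n
  laterEdges-length-unique {zero ∷ es} (zero∉ ∷ _) = s≤s (laterEdges-length (All.map (λ ne eq → ne (sym eq)) zero∉))
  laterEdges-length-unique {suc e ∷ es} (_ ∷ unique) = s≤s (laterEdges-length-unique unique)

  laterEdges-∈ : {es : List (Fin (suc k))} {e : Fin k} → e ∈ laterEdges es → suc e ∈ es
  laterEdges-∈ {zero ∷ es} e∈ = there (laterEdges-∈ e∈)
  laterEdges-∈ {suc e ∷ es} (here refl) = here refl
  laterEdges-∈ {suc e ∷ es} (there e∈) = there (laterEdges-∈ e∈)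

  laterEdges-unique : {es : List (Fin (suc k))} → Unique es → Unique (laterEdges es)
  laterEdges-unique {[]} _ = []
  laterEdges-unique {zero ∷ es} (_ ∷ unique) = laterEdges-unique unique
  laterEdges-unique {suc e ∷ es} (e∉ ∷ unique) =
    All.tabulate (λ f∈ eq → All.lookup e∉ (laterEdges-∈ f∈) (cong suc eq)) ∷ laterEdges-unique unique

  laterEdges-all : ∀ {P : Fin (suc k) → Set} {es} → All P es → All (P ∘ suc) (laterEdges es)
  laterEdges-all {es = []} _ = []
  laterEdges-all {es = zero ∷ es} (_ ∷ all) = laterEdges-all all
  laterEdges-all {es = suc e ∷ es} (p ∷ all) = p ∷ laterEdges-all all

-- Distinct edges at x have distinct positions among the entries of `neighbours x L`.
incidences-≤-neighbours : ∀ {n} (L : Multigraph n) x → AtMostIncident L x (length (neighbours x L))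
incidences-≤-neighbours [] x [] _ _ = z≤n
incidences-≤-neighbours ((p , q) ∷ L) x es unique incident
  with later ← incidences-≤-neighbours L x (laterEdges es) (laterEdges-unique unique) (laterEdges-all incident)
     | x Finₚ.≟ p | x Finₚ.≟ q
... | yes _ | _     = ≤-trans (laterEdges-length-unique unique) (s≤s later)
... | no _  | yes _ = ≤-trans (laterEdges-length-unique unique) (s≤s later)
... | no x≢p | no x≢q = ≤-trans (laterEdges-length (All.map not-first incident)) later
  where
  not-first : ∀ {e} → Incident ((p , q) ∷ L) e x → e ≢ zero
  not-first (inj₁ p≡x) refl = x≢p (sym p≡x)
  not-first (inj₂ q≡x) refl = x≢q (sym q≡x)

AtMostIncident-mono : ∀ {n} {L : Multigraph n} {x k k'} → k ≤ k' → AtMostIncident L x k → AtMostIncident L x k'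
AtMostIncident-mono k≤k' bound es unique incident = ≤-trans (bound es unique incident) k≤k'

module _ {n : ℕ} where
  neighbours-++ : ∀ (x : Fin n) L₁ L₂ → neighbours x (L₁ ++ L₂) ≡ neighbours x L₁ ++ neighbours x L₂
  neighbours-++ x [] L₂ = refl
  neighbours-++ x ((p , q) ∷ L₁) L₂ with x Finₚ.≟ p | x Finₚ.≟ q
  ... | yes _ | _     = cong (q ∷_) (neighbours-++ x L₁ L₂)
  ... | no _  | yes _ = cong (p ∷_) (neighbours-++ x L₁ L₂)
  ... | no _  | no _  = neighbours-++ x L₁ L₂

  neighbours-∈⁻ : ∀ (x : Fin n) L {y} → y ∈ neighbours x L → (x , y) ∈ L ⊎ (y , x) ∈ L
  neighbours-∈⁻ x ((p , q) ∷ L) y∈ with x Finₚ.≟ p | x Finₚ.≟ q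
  neighbours-∈⁻ x ((p , q) ∷ L) (here refl) | yes refl | _ = inj₁ (here refl)
  neighbours-∈⁻ x ((p , q) ∷ L) (here refl) | no _ | yes refl = inj₂ (here refl)
  neighbours-∈⁻ x ((p , q) ∷ L) (there y∈) | yes _ | _ = Sum.map there there (neighbours-∈⁻ x L y∈)
  neighbours-∈⁻ x ((p , q) ∷ L) (there y∈) | no _ | yes _ = Sum.map there there (neighbours-∈⁻ x L y∈)
  neighbours-∈⁻ x ((p , q) ∷ L) y∈ | no _ | no _ = Sum.map there there (neighbours-∈⁻ x L y∈)

  neighbours-∈⁺ : ∀ (x : Fin n) L {y} → (x , y) ∈ L ⊎ (y , x) ∈ L → y ∈ neighbours x L
  neighbours-∈⁺ x [] (inj₁ ())
  neighbours-∈⁺ x [] (inj₂ ())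
  neighbours-∈⁺ x ((p , q) ∷ L) xy∈ with x Finₚ.≟ p | x Finₚ.≟ q | xy∈
  ... | yes refl | _ | inj₁ (here refl) = here refl
  ... | yes refl | _ | inj₂ (here refl) = here refl
  ... | no x≢p | _ | inj₁ (here refl) = ⊥-elim (x≢p refl)
  ... | no _ | yes refl | inj₂ (here refl) = here refl
  ... | no _ | no x≢q | inj₂ (here refl) = ⊥-elim (x≢q refl)
  ... | yes _ | _ | inj₁ (there xy∈) = there (neighbours-∈⁺ x L (inj₁ xy∈))
  ... | yes _ | _ | inj₂ (there xy∈) = there (neighbours-∈⁺ x L (inj₂ xy∈))
  ... | no _ | yes _ | inj₁ (there xy∈) = there (neighbours-∈⁺ x L (inj₁ xy∈))
  ... | no _ | yes _ | inj₂ (there xy∈) = there (neighbours-∈⁺ x L (inj₂ xy∈))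
  ... | no _ | no _ | inj₁ (there xy∈) = neighbours-∈⁺ x L (inj₁ xy∈)
  ... | no _ | no _ | inj₂ (there xy∈) = neighbours-∈⁺ x L (inj₂ xy∈)

  neighbours-unique : ∀ (x : Fin n) L → Unique L → All (λ pq → toℕ (proj₁ pq) < toℕ (proj₂ pq)) L →
    Unique (neighbours x L)
  neighbours-unique x [] _ _ = []
  neighbours-unique x ((p , q) ∷ L) (pq∉ ∷ unique) (p<q ∷ increasing) with x Finₚ.≟ p | x Finₚ.≟ q
  ... | yes refl | _ = All.tabulate q-new ∷ neighbours-unique x L unique increasing
    where
    q-new : ∀ {y} → y ∈ neighbours x L → q ≢ y
    q-new y∈ refl with neighbours-∈⁻ x L y∈
    ... | inj₁ xq∈ = All.lookup pq∉ xq∈ refl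
    ... | inj₂ qx∈ = <-asym p<q (All.lookup increasing qx∈)
  ... | no _ | yes refl = All.tabulate p-new ∷ neighbours-unique x L unique increasing
    where
    p-new : ∀ {y} → y ∈ neighbours x L → p ≢ y
    p-new y∈ refl with neighbours-∈⁻ x L y∈
    ... | inj₁ xp∈ = <-asym p<q (All.lookup increasing xp∈)
    ... | inj₂ px∈ = All.lookup pq∉ px∈ refl
  ... | no _ | no _ = neighbours-unique x L unique increasing

edgeList-neighbours-≤-deg : ∀ {n} (adj : Adjacency n) → IsSimple adj → ∀ x →
  length (neighbours x (edgeList adj)) ≤ deg adj x
edgeList-neighbours-≤-deg {n} adj (symmetric , _) x =
  unique-⊆-length (neighbours-unique x (edgeList adj) (edgeList-unique adj)
                                      (All.map proj₁ (edgeList-increasing adj)))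
                  adjacent
  where
  adjacent : neighbours x (edgeList adj) ⊆ filterᵇ (adj x) (allFin n)
  adjacent {y} y∈ with neighbours-∈⁻ x (edgeList adj) y∈
  ... | inj₁ xy∈ = ∈-filterᵇ⁺ (adj x) (∈-allFin y) (proj₂ (All.lookup (edgeList-increasing adj) xy∈))
  ... | inj₂ yx∈ = ∈-filterᵇ⁺ (adj x) (∈-allFin y)
                     (subst T (symmetric y x) (proj₂ (All.lookup (edgeList-increasing adj) yx∈)))

Matched : ∀ {n} → List (Fin n × Fin n) → Fin n → Fin n → Set
Matched ps a b = (a , b) ∈ ps ⊎ (b , a) ∈ ps

module _ {n : ℕ} where
  endpoints-∈ : ∀ {ps : List (Fin n × Fin n)} {a b} → (a , b) ∈ ps → a ∈ endpoints ps × b ∈ endpoints ps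
  endpoints-∈ {_ ∷ _} (here refl) = here refl , there (here refl)
  endpoints-∈ {_ ∷ _} (there ab∈) = Product.map (there ∘ there) (there ∘ there) (endpoints-∈ ab∈)

  matched-endpoint : ∀ {ps : List (Fin n × Fin n)} {a b} → Matched ps a b → a ∈ endpoints ps
  matched-endpoint (inj₁ ab∈) = proj₁ (endpoints-∈ ab∈)
  matched-endpoint (inj₂ ba∈) = proj₂ (endpoints-∈ ba∈)

  endpoints-length : ∀ (ps : List (Fin n × Fin n)) → length (endpoints ps) ≡ 2 * length ps
  endpoints-length [] = refl
  endpoints-length (_ ∷ ps) = trans (cong (2 +_) (endpoints-length ps)) (sym (*-suc 2 (length ps)))

  neighbours-unmatched : ∀ (x : Fin n) ps → x ∉ endpoints ps → neighbours x ps ≡ []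
  neighbours-unmatched x [] _ = refl
  neighbours-unmatched x ((p , q) ∷ ps) x∉ with x Finₚ.≟ p | x Finₚ.≟ q
  ... | yes x≡p | _ = ⊥-elim (x∉ (here x≡p))
  ... | no _ | yes x≡q = ⊥-elim (x∉ (there (here x≡q)))
  ... | no _ | no _ = neighbours-unmatched x ps (x∉ ∘ there ∘ there)

  neighbours-matching : ∀ (x : Fin n) ps → Unique (endpoints ps) → length (neighbours x ps) ≤ 1
  neighbours-matching x [] _ = z≤n
  neighbours-matching x ((p , q) ∷ ps) (p∉ ∷ q∉ ∷ unique) with x Finₚ.≟ p | x Finₚ.≟ q
  ... | yes refl | _ =
    ≤-reflexive (cong (suc ∘ length) (neighbours-unmatched x ps (λ x∈ → All.lookup p∉ (there x∈) refl)))
  ... | no _ | yes refl =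
    ≤-reflexive (cong (suc ∘ length) (neighbours-unmatched x ps (λ x∈ → All.lookup q∉ x∈ refl)))
  ... | no _ | no _ = neighbours-matching x ps unique

  partner-unique : ∀ {ps : List (Fin n × Fin n)} → Unique (endpoints ps) →
    ∀ {a b c} → Matched ps a b → Matched ps a c → b ≡ c
  partner-unique {ps} unique {a} ab ac =
    at-most-one (neighbours-matching a ps unique) (neighbours-∈⁺ a ps ab) (neighbours-∈⁺ a ps ac)
    where
    at-most-one : ∀ {xs : List (Fin n)} {b c} → length xs ≤ 1 → b ∈ xs → c ∈ xs → b ≡ c
    at-most-one {_ ∷ []} _ (here refl) (here refl) = refl
    at-most-one {_ ∷ _ ∷ _} (s≤s ()) _ _

module WithMatching {c : ℕ} (adj : Adjacency (suc (suc c))) (simple : IsSimple adj)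
       (ps : List (Fin (suc (suc c)) × Fin (suc (suc c))))
       (matching : IsMatchingOn (degEq adj (suc c ∸ 2)) ps) where
  open import Data.List.Membership.DecPropositional (Finₚ._≟_ {n = suc (suc c)}) using (_∈?_)

  M : Multigraph (suc (suc c))
  M = edgeList adj ++ ps

  incidences-≤ : ∀ x → AtMostIncident M x (deg adj x + length (neighbours x ps))
  incidences-≤ x = AtMostIncident-mono {L = M} split (incidences-≤-neighbours M x)
    where
    split : length (neighbours x M) ≤ deg adj x + length (neighbours x ps)
    split = begin
      length (neighbours x M)                                      ≡⟨ cong length (neighbours-++ x (edgeList adj) ps) ⟩
      length (neighbours x (edgeList adj) ++ neighbours x ps)      ≡⟨ length-++ (neighbours x (edgeList adj)) ⟩
      length (neighbours x (edgeList adj)) + length (neighbours x ps)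
        ≤⟨ +-monoˡ-≤ _ (edgeList-neighbours-≤-deg adj simple x) ⟩
      deg adj x + length (neighbours x ps)                         ∎
      where open ≤-Reasoning

  unmatched-capacity : ∀ x → x ∉ endpoints ps → AtMostIncident M x (deg adj x)
  unmatched-capacity x x∉ = subst (AtMostIncident M x) no-partner (incidences-≤ x)
    where
    no-partner : deg adj x + length (neighbours x ps) ≡ deg adj x
    no-partner = trans (cong (λ ys → deg adj x + length ys) (neighbours-unmatched x ps x∉)) (+-identityʳ _)

  capacity : ∀ x → AtMostIncident M x (suc c)
  capacity x with x ∈? endpoints ps
  ... | no x∉ = AtMostIncident-mono {L = M} (≤-pred (deg-< adj simple x)) (unmatched-capacity x x∉)
  ... | yes x∈ = AtMostIncident-mono {L = M} bound (incidences-≤ x)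
    where
    degree : deg adj x ≡ c ∸ 1
    degree = ≡ᵇ⇒≡ _ _ (∈-filterᵇ⁻ (λ i → deg adj i ≡ᵇ (suc c ∸ 2)) {xs = allFin _}
                                   (All.lookup (proj₁ matching) x∈))
    bound : deg adj x + length (neighbours x ps) ≤ suc c
    bound = begin
      deg adj x + length (neighbours x ps) ≤⟨ +-mono-≤ (≤-reflexive degree) (neighbours-matching x ps (proj₂ matching)) ⟩
      c ∸ 1 + 1                           ≤⟨ +-monoˡ-≤ 1 (m∸n≤m c 1) ⟩
      c + 1                               ≡⟨ +-comm c 1 ⟩
      suc c                               ∎
      where open ≤-Reasoning

NonAdjacent : ∀ {n} → Multigraph n → Fin n → Fin n → Set
NonAdjacent M a b = ∀ e → ¬ Joins M e a b

module _ {n : ℕ} {M : Multigraph n} where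
  joins-incidentˡ : ∀ {e a b} → Joins M e a b → Incident M e a
  joins-incidentˡ (inj₁ (p , _)) = inj₁ p
  joins-incidentˡ (inj₂ (_ , q)) = inj₂ q

  joins-incidentʳ : ∀ {e a b} → Joins M e a b → Incident M e b
  joins-incidentʳ (inj₁ (_ , q)) = inj₂ q
  joins-incidentʳ (inj₂ (p , _)) = inj₁ p

  joins-back : ∀ {e a c c'} → Joins M e a c → Joins M e c c' → a ≡ c' ⊎ a ≡ c
  joins-back (inj₁ (p , _)) (inj₁ (q , _)) = inj₂ (trans (sym p) q)
  joins-back (inj₁ (p , _)) (inj₂ (q , _)) = inj₁ (trans (sym p) q)
  joins-back (inj₂ (_ , p)) (inj₁ (_ , q)) = inj₁ (trans (sym p) q)
  joins-back (inj₂ (_ , p)) (inj₂ (_ , q)) = inj₂ (trans (sym p) q)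

  walk-starts : ∀ {a b} (w : Walk M a b) → a ∈ walkVerts w
  walk-starts nil = here refl
  walk-starts (cons _ _ _) = here refl

  first-edge : ∀ {a b} (w : Walk M a b) → a ≢ b → Σ (EdgeOf M) λ e → e ∈ walkEdges w × Incident M e a
  first-edge nil a≢a = ⊥-elim (a≢a refl)
  first-edge (cons e j _) _ = e , here refl , joins-incidentˡ j

  last-edge : ∀ {a b} (w : Walk M a b) → a ≢ b → Σ (EdgeOf M) λ e → e ∈ walkEdges w × Incident M e b
  last-edge nil a≢a = ⊥-elim (a≢a refl)
  last-edge (cons e j w) _ = last-edge-cons e j w
    where
    last-edge-cons : ∀ {a c b} e (j : Joins M e a c) (w : Walk M c b) →
      Σ (EdgeOf M) λ f → f ∈ walkEdges (cons e j w) × Incident M f b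
    last-edge-cons e j nil = e , here refl , joins-incidentʳ j
    last-edge-cons e j (cons e' j' w) = Product.map₂ (Product.map₁ there) (last-edge-cons e' j' w)

  inner-vertex : ∀ {a b} (w : Walk M a b) → Unique (walkVerts w) → a ≢ b → NonAdjacent M a b →
    Σ (Fin n) λ c → Σ (EdgeOf M) λ e₁ → Σ (EdgeOf M) λ e₂ →
      c ≢ a × c ≢ b × e₁ ≢ e₂ × e₁ ∈ walkEdges w × e₂ ∈ walkEdges w × Incident M e₁ c × Incident M e₂ c
  inner-vertex nil _ a≢a _ = ⊥-elim (a≢a refl)
  inner-vertex (cons e₁ j₁ nil) _ _ nonadjacent = ⊥-elim (nonadjacent e₁ j₁)
  inner-vertex {a} {b} (cons {w = c} e₁ j₁ (cons e₂ j₂ rest)) (a∉ ∷ _) _ nonadjacent =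
    c , e₁ , e₂ , c≢a , c≢b , e₁≢e₂ , here refl , there (here refl) , joins-incidentʳ j₁ , joins-incidentˡ j₂
    where
    c≢a : c ≢ a
    c≢a c≡a = All.lookup a∉ (here refl) (sym c≡a)
    c≢b : c ≢ b
    c≢b refl = nonadjacent e₁ j₁
    e₁≢e₂ : e₁ ≢ e₂
    e₁≢e₂ refl with joins-back j₁ j₂
    ... | inj₁ refl = All.lookup a∉ (there (walk-starts rest)) refl
    ... | inj₂ refl = All.lookup a∉ (here refl) refl

nonadjacent-union : ∀ {n} (adj : Adjacency n) → IsSimple adj → ∀ ps {a b} →
  adj a b ≡ false → ¬ Matched ps a b → NonAdjacent (edgeList adj ++ ps) a b
nonadjacent-union adj (symmetric , _) ps {a} {b} ab-false unmatched e = not-joining (∈-lookup e)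
  where
  not-joining : ∀ {pq} → pq ∈ edgeList adj ++ ps →
    ¬ ((proj₁ pq ≡ a × proj₂ pq ≡ b) ⊎ (proj₁ pq ≡ b × proj₂ pq ≡ a))
  not-joining pq∈ (inj₁ (refl , refl)) with ∈-++⁻ (edgeList adj) pq∈
  ... | inj₁ in-G  = subst T ab-false (proj₂ (All.lookup (edgeList-increasing adj) in-G))
  ... | inj₂ in-ps = unmatched (inj₁ in-ps)
  not-joining pq∈ (inj₂ (refl , refl)) with ∈-++⁻ (edgeList adj) pq∈
  ... | inj₁ in-G  = subst T (trans (symmetric b a) ab-false) (proj₂ (All.lookup (edgeList-increasing adj) in-G))
  ... | inj₂ in-ps = unmatched (inj₂ in-ps)

Same : ∀ {X : Set} → X × X → X × X → Set
Same (a , b) (a' , b') = (a ≡ a' × b ≡ b') ⊎ (a ≡ b' × b ≡ a')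

module _ {X : Set} where
  same-sym : {p q : X × X} → Same p q → Same q p
  same-sym {_ , _} {_ , _} (inj₁ (refl , refl)) = inj₁ (refl , refl)
  same-sym {_ , _} {_ , _} (inj₂ (refl , refl)) = inj₂ (refl , refl)

  same-trans : {p q r : X × X} → Same p q → Same q r → Same p r
  same-trans {_ , _} {_ , _} {_ , _} (inj₁ (refl , refl)) qr = qr
  same-trans {_ , _} {_ , _} {_ , _} (inj₂ (refl , refl)) (inj₁ (refl , refl)) = inj₂ (refl , refl)
  same-trans {_ , _} {_ , _} {_ , _} (inj₂ (refl , refl)) (inj₂ (refl , refl)) = inj₁ (refl , refl)

  same-map : ∀ {Y : Set} (f : X → Y) {a b a' b'} → Same (a , b) (a' , b') → Same (f a , f b) (f a' , f b')
  same-map f (inj₁ (refl , refl)) = inj₁ (refl , refl)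
  same-map f (inj₂ (refl , refl)) = inj₂ (refl , refl)

same-increasing : ∀ {n} {a b a' b' : Fin n} → toℕ a < toℕ b → toℕ a' < toℕ b' →
  Same (a , b) (a' , b') → (a , b) ≡ (a' , b')
same-increasing _ _ (inj₁ (refl , refl)) = refl
same-increasing a<b a'<b' (inj₂ (refl , refl)) = ⊥-elim (<-asym a<b a'<b')

-- A pair of distinct vertices other than u, listed increasingly, that are not adjacent in M:
-- in an immersion avoiding u as a branch vertex, their route must detour through u.
DetourPair : ∀ {n} → Multigraph n → Fin n → Fin n × Fin n → Set
DetourPair M u (a , b) = toℕ a < toℕ b × a ≢ u × b ≢ u × NonAdjacent M a b

module KImmersion {c : ℕ} (M : Multigraph (suc (suc c)))
       (capacity : ∀ x → AtMostIncident M x (suc c))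
       (immersion : ImmersesK (suc c) M) where

  φ : Fin (suc c) → Fin (suc (suc c))
  φ = proj₁ immersion

  φ-injective : ∀ i j → φ i ≡ φ j → i ≡ j
  φ-injective = proj₁ (proj₂ immersion)

  route : ∀ i j → toℕ i < toℕ j → Path M (φ i) (φ j)
  route = proj₁ (proj₂ (proj₂ immersion))

  routes-disjoint : ∀ i j i' j' (p : toℕ i < toℕ j) (p' : toℕ i' < toℕ j') → ¬ (i ≡ i' × j ≡ j') →
    ∀ e → e ∈ walkEdges (walk (route i j p)) → e ∈ walkEdges (walk (route i' j' p')) → ⊥
  routes-disjoint = proj₂ (proj₂ (proj₂ immersion))

  OnRoute : Fin (suc c) → Fin (suc c) → EdgeOf M → Set
  OnRoute i j e = Σ (Fin (suc c)) λ lo → Σ (Fin (suc c)) λ hi → Σ (toℕ lo < toℕ hi) λ lo<hi →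
    Same (lo , hi) (i , j) × e ∈ walkEdges (walk (route lo hi lo<hi))

  onRoute-unique : ∀ {i j i' j' e} → OnRoute i j e → OnRoute i' j' e → Same (i , j) (i' , j')
  onRoute-unique (lo , hi , lo<hi , same , e∈) (lo' , hi' , lo<hi' , same' , e∈')
    with lo Finₚ.≟ lo' | hi Finₚ.≟ hi'
  ... | yes refl | yes refl = same-trans (same-sym same) same'
  ... | no lo≢lo' | _ = ⊥-elim (routes-disjoint lo hi lo' hi' lo<hi lo<hi' (lo≢lo' ∘ proj₁) _ e∈ e∈')
  ... | yes _ | no hi≢hi' = ⊥-elim (routes-disjoint lo hi lo' hi' lo<hi lo<hi' (hi≢hi' ∘ proj₂) _ e∈ e∈')

  onRoute-swap : ∀ {i j e} → OnRoute i j e → OnRoute j i e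
  onRoute-swap (lo , hi , lo<hi , same , e∈) = lo , hi , lo<hi , same-trans same (inj₂ (refl , refl)) , e∈

  edge-at : ∀ k l → k ≢ l → Σ (EdgeOf M) λ e → OnRoute k l e × Incident M e (φ k)
  edge-at k l k≢l with toℕ k <? toℕ l
  ... | yes k<l with e , e∈ , incident ← first-edge (walk (route k l k<l)) (k≢l ∘ φ-injective k l) =
    e , (k , l , k<l , inj₁ (refl , refl) , e∈) , incident
  ... | no k≮l
    with l<k ← ≤∧≢⇒< (≮⇒≥ k≮l) (k≢l ∘ sym ∘ Finₚ.toℕ-injective)
    with e , e∈ , incident ← last-edge (walk (route l k l<k)) (k≢l ∘ sym ∘ φ-injective l k) =
    e , (l , k , l<k , inj₂ (refl , refl) , e∈) , incident

  -- The star of k: for each of the other c branch vertices, punchIn k l, an edge at φ k on the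
  -- route to it.
  starRoute : ∀ k l → Σ (EdgeOf M) λ e → OnRoute k (punchIn k l) e × Incident M e (φ k)
  starRoute k l = edge-at k (punchIn k l) (Finₚ.punchInᵢ≢i k l ∘ sym)

  starEdge : ∀ k → Fin c → EdgeOf M
  starEdge k l = proj₁ (starRoute k l)

  star : Fin (suc c) → List (EdgeOf M)
  star k = map (starEdge k) (allFin c)

  star-length : ∀ k → length (star k) ≡ c
  star-length k = trans (length-map (starEdge k) (allFin c)) (length-tabulate {n = c} (λ i → i))

  star-onRoute : ∀ k {e} → e ∈ star k → Σ (Fin (suc c)) λ l → k ≢ l × OnRoute k l e
  star-onRoute k e∈ with l , _ , refl ← ∈-map⁻ (starEdge k) e∈ =
    punchIn k l , Finₚ.punchInᵢ≢i k l ∘ sym , proj₁ (proj₂ (starRoute k l))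

  star-incident : ∀ k → All (λ e → Incident M e (φ k)) (star k)
  star-incident k = AllP.map⁺ (All.universal (λ l → proj₂ (proj₂ (starRoute k l))) (allFin c))

  star-unique : ∀ k → Unique (star k)
  star-unique k = map⁺ starEdge-injective (allFin⁺ c)
    where
    starEdge-injective : ∀ {l l'} → starEdge k l ≡ starEdge k l' → l ≡ l'
    starEdge-injective {l} {l'} eq
      with onRoute-unique (proj₁ (proj₂ (starRoute k l)))
                          (subst (OnRoute k (punchIn k l')) (sym eq) (proj₁ (proj₂ (starRoute k l'))))
    ... | inj₁ (_ , same) = Finₚ.punchIn-injective k l l' same
    ... | inj₂ (k≡l' , _) = ⊥-elim (Finₚ.punchInᵢ≢i k l' (sym k≡l'))

  -- A route never passes through a third branch vertex: the star of that vertex already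
  -- occupies c of its at most c + 1 edges, leaving no room for two more.
  no-transit : ∀ k i j → k ≢ i → k ≢ j → ∀ e₁ e₂ → e₁ ≢ e₂ → OnRoute i j e₁ → OnRoute i j e₂ →
    Incident M e₁ (φ k) → Incident M e₂ (φ k) → ⊥
  no-transit k i j k≢i k≢j e₁ e₂ e₁≢e₂ on₁ on₂ inc₁ inc₂ =
    <-irrefl refl (subst (λ s → suc (suc s) ≤ suc c) (star-length k)
      (capacity (φ k) (e₁ ∷ e₂ ∷ star k) distinct (inc₁ ∷ inc₂ ∷ star-incident k)))
    where
    not-in-star : ∀ {e} → OnRoute i j e → e ∉ star k
    not-in-star on e∈ with _ , _ , on' ← star-onRoute k e∈ with onRoute-unique on on'
    ... | inj₁ (i≡k , _) = k≢i (sym i≡k)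
    ... | inj₂ (_ , j≡k) = k≢j (sym j≡k)
    distinct : Unique (e₁ ∷ e₂ ∷ star k)
    distinct = (e₁≢e₂ ∷ All.tabulate (λ e∈ e₁≡e → not-in-star on₁ (subst (_∈ star k) (sym e₁≡e) e∈)))
             ∷ All.tabulate (λ e∈ e₂≡e → not-in-star on₂ (subst (_∈ star k) (sym e₂≡e) e∈))
             ∷ star-unique k

  module Avoiding (u : Fin (suc (suc c))) {k : ℕ} (u-capacity : AtMostIncident M u k) (k<c : k < c) where

    -- u is not a branch vertex: it cannot hold a star of c edges.
    not-branch : ∀ i → φ i ≢ u
    not-branch i refl = <⇒≱ k<c (subst (_≤ k) (star-length i) (u-capacity (star i) (star-unique i) (star-incident i)))

    branch-onto : ∀ v → v ≢ u → Σ (Fin (suc c)) λ i → φ i ≡ v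
    branch-onto v v≢u with Finₚ.any? (λ i → φ i Finₚ.≟ v)
    ... | yes hit = hit
    ... | no miss = ⊥-elim (<-irrefl refl (≤-trans too-many (unique-Fin-length distinct)))
      where
      φ-list : List (Fin (suc (suc c)))
      φ-list = map φ (allFin (suc c))
      too-many : suc (suc (suc c)) ≤ length (u ∷ v ∷ φ-list)
      too-many = ≤-reflexive (cong (2 +_) (sym (trans (length-map φ (allFin (suc c))) (length-tabulate {n = suc c} (λ i → i)))))
      distinct : Unique (u ∷ v ∷ φ-list)
      distinct = ((v≢u ∘ sym) ∷ All.tabulate (λ x∈ u≡x → let i , _ , x≡φi = ∈-map⁻ φ x∈ in
                                                         not-branch i (sym (trans u≡x x≡φi))))
               ∷ All.tabulate (λ x∈ v≡x → let i , _ , x≡φi = ∈-map⁻ φ x∈ in miss (i , sym (trans v≡x x≡φi)))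
               ∷ map⁺ (λ {i} {j} → φ-injective i j) (allFin⁺ (suc c))

    Carries : EdgeOf M → Fin (suc (suc c)) × Fin (suc (suc c)) → Set
    Carries e (a , b) = Σ (Fin (suc c)) λ i → Σ (Fin (suc c)) λ j → φ i ≡ a × φ j ≡ b × OnRoute i j e

    carries-unique : ∀ {e a b a' b'} → toℕ a < toℕ b → toℕ a' < toℕ b' →
      Carries e (a , b) → Carries e (a' , b') → (a , b) ≡ (a' , b')
    carries-unique a<b a'<b' (i , j , refl , refl , on) (i' , j' , refl , refl , on') =
      same-increasing a<b a'<b' (same-map φ (onRoute-unique on on'))

    record ThroughU (ab : Fin (suc (suc c)) × Fin (suc (suc c))) : Set where
      field
        e₁ e₂    : EdgeOf M
        distinct : e₁ ≢ e₂
        at-u₁    : Incident M e₁ u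
        at-u₂    : Incident M e₂ u
        carries₁ : Carries e₁ ab
        carries₂ : Carries e₂ ab

    -- The route between lo and hi has an inner vertex; it is not a branch vertex by
    -- `no-transit`, so it is u.
    route-through-u : ∀ lo hi (lo<hi : toℕ lo < toℕ hi) → NonAdjacent M (φ lo) (φ hi) →
      Σ (EdgeOf M) λ e₁ → Σ (EdgeOf M) λ e₂ →
        e₁ ≢ e₂ × Incident M e₁ u × Incident M e₂ u × OnRoute lo hi e₁ × OnRoute lo hi e₂
    route-through-u lo hi lo<hi nonadjacent
      with w , e₁ , e₂ , w≢lo , w≢hi , e₁≢e₂ , e₁∈ , e₂∈ , inc₁ , inc₂
             ← inner-vertex (walk (route lo hi lo<hi)) (simple (route lo hi lo<hi))
                            (λ eq → <-irrefl (cong toℕ (φ-injective lo hi eq)) lo<hi) nonadjacent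
      with w Finₚ.≟ u
    ... | yes refl = e₁ , e₂ , e₁≢e₂ , inc₁ , inc₂ , on e₁∈ , on e₂∈
      where
      on : ∀ {e} → e ∈ walkEdges (walk (route lo hi lo<hi)) → OnRoute lo hi e
      on e∈ = lo , hi , lo<hi , inj₁ (refl , refl) , e∈
    ... | no w≢u with k′ , refl ← branch-onto w w≢u =
      ⊥-elim (no-transit k′ lo hi (w≢lo ∘ cong φ) (w≢hi ∘ cong φ) e₁ e₂ e₁≢e₂
                (lo , hi , lo<hi , inj₁ (refl , refl) , e₁∈) (lo , hi , lo<hi , inj₁ (refl , refl) , e₂∈) inc₁ inc₂)

    through-u : ∀ {ab} → DetourPair M u ab → ThroughU ab
    through-u {a , b} (a<b , a≢u , b≢u , nonadjacent)
      with i , refl ← branch-onto a a≢u | j , refl ← branch-onto b b≢u | toℕ i <? toℕ j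
    ... | yes i<j with e₁ , e₂ , e₁≢e₂ , inc₁ , inc₂ , on₁ , on₂ ← route-through-u i j i<j nonadjacent =
      record { e₁ = e₁ ; e₂ = e₂ ; distinct = e₁≢e₂ ; at-u₁ = inc₁ ; at-u₂ = inc₂
             ; carries₁ = i , j , refl , refl , on₁ ; carries₂ = i , j , refl , refl , on₂ }
    ... | no i≮j
      with j<i ← ≤∧≢⇒< (≮⇒≥ i≮j) (λ j≡i → <-irrefl (cong toℕ (cong φ (Finₚ.toℕ-injective (sym j≡i)))) a<b)
      with e₁ , e₂ , e₁≢e₂ , inc₁ , inc₂ , on₁ , on₂ ← route-through-u j i j<i (λ e → nonadjacent e ∘ Sum.swap) =
      record { e₁ = e₁ ; e₂ = e₂ ; distinct = e₁≢e₂ ; at-u₁ = inc₁ ; at-u₂ = inc₂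
             ; carries₁ = i , j , refl , refl , onRoute-swap on₁ ; carries₂ = i , j , refl , refl , onRoute-swap on₂ }

    detourEdges : ∀ NP → All (DetourPair M u) NP → List (EdgeOf M)
    detourEdges [] [] = []
    detourEdges (ab ∷ NP) (pair ∷ pairs) =
      ThroughU.e₁ (through-u pair) ∷ ThroughU.e₂ (through-u pair) ∷ detourEdges NP pairs

    detourEdges-length : ∀ NP pairs → length (detourEdges NP pairs) ≡ 2 * length NP
    detourEdges-length [] [] = refl
    detourEdges-length (ab ∷ NP) (pair ∷ pairs) = trans (cong (2 +_) (detourEdges-length NP pairs)) (sym (*-suc 2 (length NP)))

    detourEdges-at-u : ∀ NP pairs → All (λ e → Incident M e u) (detourEdges NP pairs)
    detourEdges-at-u [] [] = []
    detourEdges-at-u (ab ∷ NP) (pair ∷ pairs) =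
      ThroughU.at-u₁ (through-u pair) ∷ ThroughU.at-u₂ (through-u pair) ∷ detourEdges-at-u NP pairs

    detourEdges-carry : ∀ NP pairs {e} → e ∈ detourEdges NP pairs → Σ _ λ ab → ab ∈ NP × Carries e ab
    detourEdges-carry (ab ∷ NP) (pair ∷ pairs) (here refl) = ab , here refl , ThroughU.carries₁ (through-u pair)
    detourEdges-carry (ab ∷ NP) (pair ∷ pairs) (there (here refl)) = ab , here refl , ThroughU.carries₂ (through-u pair)
    detourEdges-carry (ab ∷ NP) (pair ∷ pairs) (there (there e∈)) =
      Product.map₂ (Product.map₁ there) (detourEdges-carry NP pairs e∈)

    -- Routes of distinct pairs are edge-disjoint, so all these edges are distinct.
    detourEdges-unique : ∀ NP pairs → Unique NP → Unique (detourEdges NP pairs)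
    detourEdges-unique [] [] _ = []
    detourEdges-unique ((a , b) ∷ NP) (pair ∷ pairs) (ab∉ ∷ unique) =
      (ThroughU.distinct (through-u pair) ∷ All.tabulate (fresh (ThroughU.carries₁ (through-u pair))))
      ∷ All.tabulate (fresh (ThroughU.carries₂ (through-u pair)))
      ∷ detourEdges-unique NP pairs unique
      where
      fresh : ∀ {e} → Carries e (a , b) → ∀ {f} → f ∈ detourEdges NP pairs → e ≢ f
      fresh carries f∈ refl with (a' , b') , ab'∈ , carries' ← detourEdges-carry NP pairs f∈ =
        All.lookup ab∉ ab'∈ (carries-unique (proj₁ pair) (proj₁ (All.lookup pairs ab'∈)) carries carries')

    -- The counting bound: each detour pair costs two of the k edges at u.
    detours-≤ : ∀ NP → Unique NP → All (DetourPair M u) NP → 2 * length NP ≤ k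
    detours-≤ NP unique pairs =
      subst (_≤ k) (detourEdges-length NP pairs)
        (u-capacity (detourEdges NP pairs) (detourEdges-unique NP pairs unique) (detourEdges-at-u NP pairs))

not-T : ∀ b → T (not b) → b ≡ false
not-T false _ = refl

≡ᵇ-refl : ∀ a → (a ≡ᵇ a) ≡ true
≡ᵇ-refl zero = refl
≡ᵇ-refl (suc a) = ≡ᵇ-refl a

≡ᵇ-sym : ∀ a b → (a ≡ᵇ b) ≡ (b ≡ᵇ a)
≡ᵇ-sym zero zero = refl
≡ᵇ-sym zero (suc b) = refl
≡ᵇ-sym (suc a) zero = refl
≡ᵇ-sym (suc a) (suc b) = ≡ᵇ-sym a b

≢⇒≡ᵇ-false : ∀ {a b} → a ≢ b → (a ≡ᵇ b) ≡ false
≢⇒≡ᵇ-false {a} {b} a≢b = ¬-not (a≢b ∘ ≡ᵇ⇒≡ a b ∘ Equivalence.from T-≡)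

≡⇒≡ᵇ-true : ∀ {a b} → a ≡ b → (a ≡ᵇ b) ≡ true
≡⇒≡ᵇ-true {a} refl = ≡ᵇ-refl a

P5-simple : ∀ d → IsSimple (P5 d)
P5-simple d = symmetric , loopless
  where
  symmetric : ∀ i j → P5 d i j ≡ P5 d j i
  symmetric i j rewrite ≡ᵇ-sym (toℕ i) (toℕ j) | ∨-comm (delPair (toℕ i) (toℕ j)) (delPair (toℕ j) (toℕ i)) = refl
  loopless : ∀ i → P5 d i i ≡ false
  loopless i rewrite ≡ᵇ-refl (toℕ i) = refl

mate : ℕ → ℕ
mate 0 = 1
mate 1 = 0
mate (suc (suc s)) = suc (suc (mate s))

same-half : ∀ s t → ⌊ s /2⌋ ≡ ⌊ t /2⌋ → t ≡ s ⊎ t ≡ mate s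
same-half 0 0 _ = inj₁ refl
same-half 0 1 _ = inj₂ refl
same-half 1 0 _ = inj₂ refl
same-half 1 1 _ = inj₁ refl
same-half (suc (suc s)) (suc (suc t)) eq = Sum.map (cong (2 +_)) (cong (2 +_)) (same-half s t (suc-injective eq))
same-half 0 (suc (suc t)) ()
same-half 1 (suc (suc t)) ()
same-half (suc (suc s)) 0 ()
same-half (suc (suc s)) 1 ()

adjacentℕ : ℕ → ℕ → Bool
adjacentℕ a b = not (a ≡ᵇ b) ∧ not (delPair a b ∨ delPair b a)

-- adjacentℕ (9 + s) (9 + t), as it evaluates on high vertices.
highAdjacent : ℕ → ℕ → Bool
highAdjacent s t =
  not (s ≡ᵇ t) ∧ not ((not (s ≡ᵇ t) ∧ (⌊ s /2⌋ ≡ᵇ ⌊ t /2⌋)) ∨ (not (t ≡ᵇ s) ∧ (⌊ t /2⌋ ≡ᵇ ⌊ s /2⌋)))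

highAdjacent-spec : ∀ s t → highAdjacent s t ≡ not (s ≡ᵇ t) ∧ not (⌊ s /2⌋ ≡ᵇ ⌊ t /2⌋)
highAdjacent-spec s t rewrite ≡ᵇ-sym t s | ≡ᵇ-sym ⌊ t /2⌋ ⌊ s /2⌋ with s ≡ᵇ t | ⌊ s /2⌋ ≡ᵇ ⌊ t /2⌋
... | true  | _     = refl
... | false | true  = refl
... | false | false = refl

high-nonadjacent : ∀ s t → highAdjacent s t ≡ false → t ≡ s ⊎ t ≡ mate s
high-nonadjacent s t nonadjacent rewrite highAdjacent-spec s t
  with s ≡ᵇ t in s≡ᵇt | ⌊ s /2⌋ ≡ᵇ ⌊ t /2⌋ in halves≡ᵇ
... | true  | _     = inj₁ (sym (≡ᵇ⇒≡ s t (Equivalence.from T-≡ s≡ᵇt)))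
... | false | true  = same-half s t (≡ᵇ⇒≡ _ _ (Equivalence.from T-≡ halves≡ᵇ))
... | false | false = case nonadjacent of λ ()

mates-nonadjacent : ∀ s t → t ≡ suc s → ⌊ s /2⌋ ≡ ⌊ t /2⌋ → highAdjacent s t ≡ false
mates-nonadjacent s .(suc s) refl halves
  rewrite highAdjacent-spec s (suc s) | ≢⇒≡ᵇ-false (<⇒≢ (n<1+n s)) | ≡⇒≡ᵇ-true halves = refl

-- The pairs {0,1}, {2,3}, ... of Fin k: the matching deleted from the high vertices.
shift₂ : ∀ {k} → Fin k × Fin k → Fin (2 + k) × Fin (2 + k)
shift₂ (s , t) = suc (suc s) , suc (suc t)

matePairs : (k : ℕ) → List (Fin k × Fin k)
matePairs zero = []
matePairs (suc zero) = []
matePairs (suc (suc k)) = (zero , suc zero) ∷ map shift₂ (matePairs k)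

Mates : ∀ {k} → Fin k × Fin k → Set
Mates (s , t) = toℕ t ≡ suc (toℕ s) × ⌊ toℕ s /2⌋ ≡ ⌊ toℕ t /2⌋

matePairs-length : ∀ k → length (matePairs k) ≡ ⌊ k /2⌋
matePairs-length zero = refl
matePairs-length (suc zero) = refl
matePairs-length (suc (suc k)) = cong suc (trans (length-map shift₂ (matePairs k)) (matePairs-length k))

matePairs-mates : ∀ k → All Mates (matePairs k)
matePairs-mates zero = []
matePairs-mates (suc zero) = []
matePairs-mates (suc (suc k)) = (refl , refl) ∷ AllP.map⁺ (All.map shift-mates (matePairs-mates k))
  where
  shift-mates : ∀ {st} → Mates st → Mates (shift₂ st)
  shift-mates (t≡1+s , halves) = cong (2 +_) t≡1+s , cong suc halves

matePairs-unique : ∀ k → Unique (matePairs k)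
matePairs-unique zero = []
matePairs-unique (suc zero) = []
matePairs-unique (suc (suc k)) =
  AllP.map⁺ (All.universal first-not-shifted (matePairs k)) ∷ map⁺ shift₂-injective (matePairs-unique k)
  where
  first-not-shifted : ∀ (st : Fin k × Fin k) → (zero , suc zero) ≢ shift₂ st
  first-not-shifted (s , t) ()
  shift₂-injective : ∀ {st st' : Fin k × Fin k} → shift₂ st ≡ shift₂ st' → st ≡ st'
  shift₂-injective {_ , _} {_ , _} refl = refl

too-many-detours : ∀ m → ¬ (2 * (4 + ⌊ m /2⌋) ≤ 6 + m)
too-many-detours m bound =
  <-irrefl refl (≤-trans (+-cancelˡ-≤ 6 _ _ (subst (_≤ 6 + m) (*-distribˡ-+ 2 4 ⌊ m /2⌋) bound)) (m≤1+2⌊m/2⌋ m))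
  where
  m≤1+2⌊m/2⌋ : ∀ n → n ≤ suc (2 * ⌊ n /2⌋)
  m≤1+2⌊m/2⌋ zero = z≤n
  m≤1+2⌊m/2⌋ (suc zero) = s≤s z≤n
  m≤1+2⌊m/2⌋ (suc (suc n)) = s≤s (subst (suc n ≤_) (sym (*-suc 2 ⌊ n /2⌋)) (s≤s (m≤1+2⌊m/2⌋ n)))

-- From here on d = 8 + m.  The vertices 0..8 of P^5_d are "low" (i ↑ˡ m for i : Fin 9),
-- the vertices 9..d "high" (9 ↑ʳ s for s : Fin m).
module P5Graph (m : ℕ) where

  V : Set
  V = Fin (9 + m)

  G : Adjacency (9 + m)
  G = P5 (8 + m)

  low : Fin 9 → V
  low i = i ↑ˡ m

  high : Fin m → V
  high s = 9 ↑ʳ s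

  highs : List V
  highs = tabulate high

  data Position : V → Set where
    low-vertex  : ∀ i → Position (low i)
    high-vertex : ∀ s → Position (high s)

  position : ∀ x → Position x
  position x with splitAt 9 x in split
  ... | inj₁ i = subst Position (Finₚ.splitAt⁻¹-↑ˡ split) (low-vertex i)
  ... | inj₂ s = subst Position (Finₚ.splitAt⁻¹-↑ʳ split) (high-vertex s)

  P5-low : ∀ a b → G (low a) (low b) ≡ P5 8 a b
  P5-low a b = cong₂ adjacentℕ (Finₚ.toℕ-↑ˡ a m) (Finₚ.toℕ-↑ˡ b m)

  high≢low : ∀ s i → high s ≢ low i
  high≢low s i eq = <⇒≢ low<high (cong toℕ (sym eq))
    where
    low<high : toℕ (low i) < toℕ (high s)
    low<high = subst (_< toℕ (high s)) (sym (Finₚ.toℕ-↑ˡ i m)) (≤-trans (Finₚ.toℕ<n i) (m≤m+n 9 (toℕ s)))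

  all-highs-adjacent : ∀ x → (∀ t → T (G x (high t))) → length (filterᵇ (G x) highs) ≡ m
  all-highs-adjacent x adjacent =
    trans (cong length (filter-all (T? ∘ G x) (AllP.tabulate⁺ adjacent))) (length-tabulate high)

  -- Each low vertex is adjacent to all high vertices, so its degree exceeds its degree in
  -- P^5_8 by m.  (Each case is a direct computation.)
  degree-low : ∀ i → deg G (low i) ≡ deg (P5 8) i + m
  degree-low i@zero = cong (deg (P5 8) i +_) (all-highs-adjacent (low i) (λ _ → tt))
  degree-low i@(suc zero) = cong (deg (P5 8) i +_) (all-highs-adjacent (low i) (λ _ → tt))
  degree-low i@(suc (suc zero)) = cong (deg (P5 8) i +_) (all-highs-adjacent (low i) (λ _ → tt))
  degree-low i@(suc (suc (suc zero))) = cong (deg (P5 8) i +_) (all-highs-adjacent (low i) (λ _ → tt))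
  degree-low i@(suc (suc (suc (suc zero)))) = cong (deg (P5 8) i +_) (all-highs-adjacent (low i) (λ _ → tt))
  degree-low i@(suc (suc (suc (suc (suc zero))))) = cong (deg (P5 8) i +_) (all-highs-adjacent (low i) (λ _ → tt))
  degree-low i@(suc (suc (suc (suc (suc (suc zero)))))) = cong (deg (P5 8) i +_) (all-highs-adjacent (low i) (λ _ → tt))
  degree-low i@(suc (suc (suc (suc (suc (suc (suc zero))))))) = cong (deg (P5 8) i +_) (all-highs-adjacent (low i) (λ _ → tt))
  degree-low i@(suc (suc (suc (suc (suc (suc (suc (suc zero)))))))) = cong (deg (P5 8) i +_) (all-highs-adjacent (low i) (λ _ → tt))

  degree-P5-8 : ∀ (i : Fin 9) → 6 ≤ deg (P5 8) i
  degree-P5-8 = from-yes (Finₚ.all? (λ i → 6 ≤? deg (P5 8) i))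

  high-non-neighbours : ∀ s → length (filterᵇ (not ∘ G (high s)) highs) ≤ 2
  high-non-neighbours s = subst (_≤ 2) (length-map toℕ non-neighbours)
    (unique-⊆-length (map⁺ Finₚ.toℕ-injective (filter⁺ _ (tabulate⁺ (Finₚ.↑ʳ-injective 9 _ _))))
                     self-or-mate)
    where
    non-neighbours : List V
    non-neighbours = filterᵇ (not ∘ G (high s)) highs
    self-or-mate : map toℕ non-neighbours ⊆ 9 + toℕ s ∷ 9 + mate (toℕ s) ∷ []
    self-or-mate z∈ with x , x∈ , refl ← ∈-map⁻ toℕ z∈
                    with t , refl ← ∈-tabulate⁻ (proj₁ (∈-filter⁻ (T? ∘ not ∘ G (high s)) {xs = highs} x∈))
                    with high-nonadjacent (toℕ s) (toℕ t) (not-T _ (∈-filterᵇ⁻ (not ∘ G (high s)) {xs = highs} x∈))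
    ... | inj₁ t≡s = here (cong (9 +_) t≡s)
    ... | inj₂ t≡mate = there (here (cong (9 +_) t≡mate))

  -- A high vertex is adjacent to all nine low vertices (by evaluation) and misses at most two
  -- high ones, so its degree is at least 9 + (m - 2).
  degree-high : ∀ s → 7 + m ≤ deg G (high s)
  degree-high s = begin
    7 + m                    ≡⟨ cong (7 +_) (sym split) ⟩
    7 + (adjacent + missing) ≤⟨ +-monoʳ-≤ 7 (+-monoʳ-≤ adjacent (high-non-neighbours s)) ⟩
    7 + (adjacent + 2)       ≡⟨ cong (7 +_) (+-comm adjacent 2) ⟩
    deg G (high s)           ∎
    where
    open ≤-Reasoning
    adjacent missing : ℕ
    adjacent = length (filterᵇ (G (high s)) highs)
    missing = length (filterᵇ (not ∘ G (high s)) highs)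
    split : adjacent + missing ≡ m
    split = trans (length-filter-complement (G (high s)) highs) (length-tabulate high)

  A : List V
  A = degEq G (6 + m)

  tight : List (Fin 9)
  tight = filterᵇ (λ i → deg (P5 8) i ≡ᵇ 6) (allFin 9)

  A-degree : ∀ {x} → x ∈ A → deg G x ≡ 6 + m
  A-degree x∈ = ≡ᵇ⇒≡ _ _ (∈-filterᵇ⁻ (λ i → deg G i ≡ᵇ (6 + m)) {xs = allFin (9 + m)} x∈)

  A⊆tight : A ⊆ map low tight
  A⊆tight {x} x∈ with position x
  ... | low-vertex i = ∈-map⁺ low (∈-filterᵇ⁺ (λ i → deg (P5 8) i ≡ᵇ 6) (∈-allFin i) (≡⇒≡ᵇ _ _ deg6))
    where
    deg6 : deg (P5 8) i ≡ 6
    deg6 = +-cancelʳ-≡ _ _ _ (trans (sym (degree-low i)) (A-degree x∈))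
  ... | high-vertex s = ⊥-elim (<-irrefl refl (subst (7 + m ≤_) (A-degree x∈) (degree-high s)))

  A-length : length A ≤ 5
  A-length = unique-⊆-length (filter⁺ (T? ∘ (λ i → deg G i ≡ᵇ (6 + m))) (allFin⁺ (9 + m))) A⊆tight

  degree-≥ : ∀ x → 6 + m ≤ deg G x
  degree-≥ x with position x
  ... | low-vertex i = subst (6 + m ≤_) (sym (degree-low i)) (+-monoˡ-≤ m (degree-P5-8 i))
  ... | high-vertex s = ≤-trans (n≤1+n _) (degree-high s)

  module Matching (ps : List (V × V)) (matching : IsMatchingOn A ps) (maximum : length ps ≡ ⌊ length A /2⌋) where
    open import Data.List.Membership.DecPropositional (Finₚ._≟_ {n = 9 + m}) using (_∈?_)
    open import Data.List.Membership.DecPropositional (≡-dec (Finₚ._≟_ {n = 9 + m}) (Finₚ._≟_ {n = 9 + m}))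
      using () renaming (_∈?_ to _∈ₚ?_)
    open import Data.List.Relation.Unary.Unique.DecPropositional (≡-dec (Finₚ._≟_ {n = 9}) (Finₚ._≟_ {n = 9}))
      using (unique?)
    open WithMatching G (P5-simple (8 + m)) ps matching public

    loose-unmatched : ∀ x → 7 + m ≤ deg G x → x ∉ endpoints ps
    loose-unmatched x bound x∈ =
      <-irrefl refl (subst (7 + m ≤_) (A-degree (All.lookup (proj₁ matching) x∈)) bound)

    loose-left : ∀ a {y} → deg (P5 8) a ≡ 7 → ¬ Matched ps (low a) y
    loose-left a deg7 matched =
      loose-unmatched (low a) (≤-reflexive (sym (trans (degree-low a) (cong (_+ m) deg7)))) (matched-endpoint matched)

    loose-right : ∀ b {x} → deg (P5 8) b ≡ 7 → ¬ Matched ps x (low b)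
    loose-right b deg7 = loose-left b deg7 ∘ Sum.swap

    -- A matching on at most five vertices covers at most four, so a tight vertex is unmatched.
    unmatched-tight : Σ (Fin 9) λ i → deg (P5 8) i ≡ 6 × low i ∉ endpoints ps
    unmatched-tight with Any.any? (λ i → ¬? (low i ∈? endpoints ps)) tight
    ... | yes some with i , i∈ , i∉ ← find some =
      i , ≡ᵇ⇒≡ _ _ (∈-filterᵇ⁻ (λ i → deg (P5 8) i ≡ᵇ 6) {xs = allFin 9} i∈) , i∉
    ... | no none = ⊥-elim (<-irrefl refl (≤-trans five-matched (≤-trans endpoints≤ four)))
      where
      all-matched : map low tight ⊆ endpoints ps
      all-matched x∈ with i , i∈ , refl ← ∈-map⁻ low x∈ =
        decidable-stable (low i ∈? endpoints ps) (λ i∉ → none (lose i∈ i∉))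
      five-matched : 5 ≤ length (endpoints ps)
      five-matched =
        unique-⊆-length (map⁺ (Finₚ.↑ˡ-injective m _ _) (filter⁺ (T? ∘ (λ i → deg (P5 8) i ≡ᵇ 6)) (allFin⁺ 9)))
                        all-matched
      endpoints≤ : length (endpoints ps) ≤ 2 * ⌊ length A /2⌋
      endpoints≤ = ≤-reflexive (trans (endpoints-length ps) (cong (2 *_) maximum))
      four : 2 * ⌊ length A /2⌋ ≤ 4
      four = *-monoʳ-≤ 2 (⌊n/2⌋-mono A-length)

    Matched? : ∀ a b → Dec (Matched ps a b)
    Matched? a b = ((a , b) ∈ₚ? ps) ⊎-dec ((b , a) ∈ₚ? ps)

    -- Conditions on a pair (a , b) of low vertices that can be checked by evaluation:
    -- increasing, non-adjacent in P^5_8, and avoiding u.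
    LowPairOK : Fin 9 → Fin 9 × Fin 9 → Set
    LowPairOK u (a , b) = toℕ a < toℕ b × a ≢ u × b ≢ u × P5 8 a b ≡ false

    lowPairOK? : ∀ u ab → Dec (LowPairOK u ab)
    lowPairOK? u (a , b) =
      (toℕ a <? toℕ b) ×-dec ¬? (a Finₚ.≟ u) ×-dec ¬? (b Finₚ.≟ u) ×-dec (P5 8 a b Boolₚ.≟ false)

    -- The part that depends on the matching: the pair is not matched.
    Free : Fin 9 × Fin 9 → Set
    Free (a , b) = ¬ Matched ps (low a) (low b)

    lowPair : Fin 9 × Fin 9 → V × V
    lowPair (a , b) = low a , low b

    low-detour : ∀ {u ab} → LowPairOK u ab → Free ab → DetourPair M (low u) (lowPair ab)
    low-detour {u} {a , b} (a<b , a≢u , b≢u , nonadjacent) free =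
      subst₂ _<_ (sym (Finₚ.toℕ-↑ˡ a m)) (sym (Finₚ.toℕ-↑ˡ b m)) a<b ,
      a≢u ∘ Finₚ.↑ˡ-injective m a u , b≢u ∘ Finₚ.↑ˡ-injective m b u ,
      nonadjacent-union G (P5-simple (8 + m)) ps (trans (P5-low a b) nonadjacent) free

    record LowDetours (u : Fin 9) : Set where
      field
        pairs    : List (Fin 9 × Fin 9)
        four     : length pairs ≡ 4
        distinct : Unique pairs
        checked  : All (LowPairOK u) pairs
        free     : All Free pairs

    LowChecks : Fin 9 → List (Fin 9 × Fin 9) → Set
    LowChecks u pairs = length pairs ≡ 4 × Unique pairs × All (LowPairOK u) pairs

    lowChecks? : ∀ u pairs → Dec (LowChecks u pairs)
    lowChecks? u pairs = (length pairs ℕₚ.≟ 4) ×-dec unique? pairs ×-dec All.all? (lowPairOK? u) pairs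

    lowDetours : ∀ {u} pairs → All Free pairs → {True (lowChecks? u pairs)} → LowDetours u
    lowDetours pairs free {ok} with four , distinct , checked ← toWitness ok =
      record { pairs = pairs ; four = four ; distinct = distinct ; checked = checked ; free = free }

    -- The sides of the deleted paths 0-1-2 and 3-4-5 are free: each has an end of degree d - 1.
    path012 path345 : List (Fin 9 × Fin 9)
    path012 = (# 0 , # 1) ∷ (# 1 , # 2) ∷ []
    path345 = (# 3 , # 4) ∷ (# 4 , # 5) ∷ []

    path012-free : All Free path012
    path012-free = loose-left (# 0) refl ∷ loose-right (# 2) refl ∷ []

    path345-free : All Free path345
    path345-free = loose-left (# 3) refl ∷ loose-right (# 5) refl ∷ []

    both-paths : List (Fin 9 × Fin 9)
    both-paths = path012 ++ path345

    both-paths-free : All Free both-paths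
    both-paths-free = AllP.++⁺ path012-free path345-free

    side67 side68 side78 : Fin 9 × Fin 9
    side67 = # 6 , # 7
    side68 = # 6 , # 8
    side78 = # 7 , # 8

    -- A matching contains at most one side of the triangle; the two free sides complete two
    -- free path sides to four detour pairs.
    with-triangle : ∀ {u} path → All Free path →
      {True (lowChecks? u (path ++ side68 ∷ side78 ∷ []))} →
      {True (lowChecks? u (path ++ side67 ∷ side78 ∷ []))} →
      {True (lowChecks? u (path ++ side67 ∷ side68 ∷ []))} → LowDetours u
    with-triangle path free {ok₁} {ok₂} {ok₃} with Matched? (low (# 6)) (low (# 7)) | Matched? (low (# 6)) (low (# 8))
    ... | yes m67 | _ = lowDetours (path ++ side68 ∷ side78 ∷ []) (AllP.++⁺ free (free68 ∷ free78 ∷ [])) {ok₁}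
      where
      free68 : Free side68
      free68 m68 = case partner-unique (proj₂ matching) m67 m68 of λ ()
      free78 : Free side78
      free78 m78 = case partner-unique (proj₂ matching) (Sum.swap m67) m78 of λ ()
    ... | no free67 | yes m68 = lowDetours (path ++ side67 ∷ side78 ∷ []) (AllP.++⁺ free (free67 ∷ free78 ∷ [])) {ok₂}
      where
      free78 : Free side78
      free78 m78 = case partner-unique (proj₂ matching) (Sum.swap m68) (Sum.swap m78) of λ ()
    ... | no free67 | no free68 = lowDetours (path ++ side67 ∷ side68 ∷ []) (AllP.++⁺ free (free67 ∷ free68 ∷ [])) {ok₃}

    -- Four low detour pairs for each tight vertex: the two paths if u is on the triangle,
    -- otherwise the other path and two free triangle sides.
    lowDetoursFor : ∀ i → deg (P5 8) i ≡ 6 → LowDetours i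
    lowDetoursFor zero ()
    lowDetoursFor (suc zero) _ = with-triangle path345 path345-free
    lowDetoursFor (suc (suc zero)) ()
    lowDetoursFor (suc (suc (suc zero))) ()
    lowDetoursFor (suc (suc (suc (suc zero)))) _ = with-triangle path012 path012-free
    lowDetoursFor (suc (suc (suc (suc (suc zero))))) ()
    lowDetoursFor (suc (suc (suc (suc (suc (suc zero)))))) _ = lowDetours both-paths both-paths-free
    lowDetoursFor (suc (suc (suc (suc (suc (suc (suc zero))))))) _ = lowDetours both-paths both-paths-free
    lowDetoursFor (suc (suc (suc (suc (suc (suc (suc (suc zero)))))))) _ = lowDetours both-paths both-paths-free

    highPair : Fin m × Fin m → V × V
    highPair (s , t) = high s , high t

    high-detour : ∀ u {st} → Mates st → DetourPair M (low u) (highPair st)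
    high-detour u {s , t} (t≡1+s , halves) =
      increasing , high≢low s u , high≢low t u , nonadjacent-union G (P5-simple (8 + m)) ps nonadjacent unmatched
      where
      increasing : toℕ (high s) < toℕ (high t)
      increasing = +-monoʳ-< 9 (subst (toℕ s <_) (sym t≡1+s) (n<1+n (toℕ s)))
      nonadjacent : G (high s) (high t) ≡ false
      nonadjacent = mates-nonadjacent (toℕ s) (toℕ t) t≡1+s halves
      unmatched : ¬ Matched ps (high s) (high t)
      unmatched = loose-unmatched (high s) (degree-high s) ∘ matched-endpoint

    module Detours {u : Fin 9} (D : LowDetours u) where
      open LowDetours D

      detourPairs : List (V × V)
      detourPairs = map lowPair pairs ++ map highPair (matePairs m)

      detourPairs-length : length detourPairs ≡ 4 + ⌊ m /2⌋
      detourPairs-length = begin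
        length detourPairs                                           ≡⟨ length-++ (map lowPair pairs) ⟩
        length (map lowPair pairs) + length (map highPair (matePairs m))
          ≡⟨ cong₂ _+_ (length-map lowPair pairs) (length-map highPair (matePairs m)) ⟩
        length pairs + length (matePairs m)                           ≡⟨ cong₂ _+_ four (matePairs-length m) ⟩
        4 + ⌊ m /2⌋                                                   ∎
        where open ≡-Reasoning

      detourPairs-unique : Unique detourPairs
      detourPairs-unique = ++⁺ (map⁺ lowPair-injective distinct) (map⁺ highPair-injective (matePairs-unique m)) low-high-disjoint
        where
        lowPair-injective : ∀ {ab ab'} → lowPair ab ≡ lowPair ab' → ab ≡ ab'
        lowPair-injective {a , b} {a' , b'} eq =
          cong₂ _,_ (Finₚ.↑ˡ-injective m a a' (cong proj₁ eq)) (Finₚ.↑ˡ-injective m b b' (cong proj₂ eq))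
        highPair-injective : ∀ {st st'} → highPair st ≡ highPair st' → st ≡ st'
        highPair-injective {s , t} {s' , t'} eq =
          cong₂ _,_ (Finₚ.↑ʳ-injective 9 s s' (cong proj₁ eq)) (Finₚ.↑ʳ-injective 9 t t' (cong proj₂ eq))
        low-high-disjoint : Disjoint (map lowPair pairs) (map highPair (matePairs m))
        low-high-disjoint (x∈low , x∈high) with (a , b) , _ , refl ← ∈-map⁻ lowPair x∈low
                                              | (s , t) , _ , eq ← ∈-map⁻ highPair x∈high =
          high≢low s a (sym (cong proj₁ eq))

      detourPairs-detours : All (DetourPair M (low u)) detourPairs
      detourPairs-detours = AllP.++⁺ (AllP.map⁺ (All.zipWith (λ (ok , free) → low-detour ok free) (checked , free)))
                                     (AllP.map⁺ (All.map (high-detour u) (matePairs-mates m)))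

    no-immersion : ¬ ImmersesK (8 + m) M
    no-immersion immersion with i , i-tight , i-unmatched ← unmatched-tight =
      too-many-detours m (subst (_≤ 6 + m) (cong (2 *_) detourPairs-length)
        (KImmersion.Avoiding.detours-≤ M capacity immersion (low i) u-capacity (n<1+n (6 + m))
           detourPairs detourPairs-unique detourPairs-detours))
      where
      open Detours (lowDetoursFor i i-tight)
      u-capacity : AtMostIncident M (low i) (6 + m)
      u-capacity = AtMostIncident-mono {L = M} (≤-reflexive (trans (degree-low i) (cong (_+ m) i-tight)))
                                       (unmatched-capacity (low i) i-unmatched)

lemma4p15 : (d : ℕ) → 8 ≤ d → IsPod d (P5 d)
lemma4p15 d 8≤d with m , refl ← m≤n⇒∃[o]m+o≡n 8≤d =
  P5-simple (8 + m) , P5Graph.degree-≥ m , ≤-trans (P5Graph.A-length m) (m≤m+n 5 (1 + m)) ,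
  λ ps (matching , maximum) → P5Graph.Matching.no-immersion m ps matching maximum
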